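{- Let $n$ be a positive integer and $\mathcal D^n_{\rm coord}=\{\mathbf d\in\mathbb Z^n : d_i=0\text{ for at least one }i\in[n]\}$. Then for any function $f\colon\mathcal D^n_{\rm coord}\to\mathbb Z$ there exist functions $h_i\colon\mathbb Z^n\to\mathbb Z$, $i\in[n]$, such that each $h_i(\mathbf d)$ is independent of the $i$-th variable $d_i$, and $f(\mathbf d)=\sum_{i=1}^nh_i(\mathbf d)$ for all $\mathbf d\in\mathcal D^n_{\rm coord}$. -}

module Defs where

open import Data.Nat using (ℕ)
open import Data.Integer using (ℤ; 0ℤ; _+_)
open import Data.Fin using (Fin)
open import Data.Vec using (Vec; lookup)
open import Data.Product using (∃)
open import Relation.Binary.PropositionalEquality using (_≡_)

InDcoord : {n : ℕ} → Vec ℤ n → Set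
InDcoord {n} d = ∃ λ (i : Fin n) → lookup d i ≡ 0ℤ

sumFin : (n : ℕ) → (Fin n → ℤ) → ℤ
sumFin ℕ.zero    g = 0ℤ
sumFin (ℕ.suc n) g = g Fin.zero + sumFin n (λ i → g (Fin.suc i))

module Submission where

-- Induct on the first coordinate, writing d = x ∷ e:
--   f (x ∷ e) = f (0 ∷ e) + [x ≠ 0] · (f (x ∷ e) − f (0 ∷ e)).
-- The first summand does not depend on x. For x ≠ 0 the tail e must have a
-- zero coordinate, so the difference, as a function of e, splits by induction
-- into summands each independent of one of the remaining coordinates, and
-- multiplying them by [x ≠ 0] keeps that independence.

open import Defs
open import Data.Nat using (ℕ; NonZero)
open import Data.Integer using (ℤ; 0ℤ; _+_; _-_)
open import Data.Integer.Properties using (_≟_; +-identityʳ)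
open import Data.Integer.Tactic.RingSolver using (solve-∀)
open import Data.Fin using (Fin)
open import Data.Vec using (Vec; _∷_; _[_]≔_)
open import Data.Product using (Σ; _×_; _,_)
open import Relation.Nullary using (¬_; yes; no; contradiction)
open import Relation.Binary.PropositionalEquality using (_≡_; refl; cong; module ≡-Reasoning)

sumFin-0 : ∀ n → sumFin n (λ _ → 0ℤ) ≡ 0ℤ
sumFin-0 ℕ.zero    = refl
sumFin-0 (ℕ.suc n) = cong (0ℤ +_) (sumFin-0 n)

+-minus-cancel : ∀ a b → b + (a - b) ≡ a
+-minus-cancel = solve-∀

InDcoord-tail : ∀ {n x} {e : Vec ℤ n} → ¬ x ≡ 0ℤ → InDcoord (x ∷ e) → InDcoord e
InDcoord-tail x≢0 (Fin.zero  , x≡0) = contradiction x≡0 x≢0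
InDcoord-tail x≢0 (Fin.suc i , eᵢ≡0) = i , eᵢ≡0

Δ : ∀ {n} → (Vec ℤ (ℕ.suc n) → ℤ) → ℤ → Vec ℤ n → ℤ
Δ f x e = f (x ∷ e) - f (0ℤ ∷ e)

decompose : ∀ n → (Vec ℤ n → ℤ) → Fin n → Vec ℤ n → ℤ
decompose (ℕ.suc n) f Fin.zero    (x ∷ e) = f (0ℤ ∷ e)
decompose (ℕ.suc n) f (Fin.suc i) (x ∷ e) with x ≟ 0ℤ
... | yes _ = 0ℤ
... | no  _ = decompose n (Δ f x) i e

decompose-[]≔ : ∀ n f i (d : Vec ℤ n) y → decompose n f i (d [ i ]≔ y) ≡ decompose n f i d
decompose-[]≔ (ℕ.suc n) f Fin.zero    (x ∷ e) y = refl
decompose-[]≔ (ℕ.suc n) f (Fin.suc i) (x ∷ e) y with x ≟ 0ℤ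
... | yes _ = refl
... | no  _ = decompose-[]≔ n (Δ f x) i e y

decompose-sum : ∀ n f (d : Vec ℤ n) → InDcoord d → f d ≡ sumFin n (λ i → decompose n f i d)
decompose-sum (ℕ.suc n) f (x ∷ e) d∈D with x ≟ 0ℤ
... | yes refl = begin
  f (0ℤ ∷ e)                      ≡⟨ +-identityʳ _ ⟨
  f (0ℤ ∷ e) + 0ℤ                 ≡⟨ cong (f (0ℤ ∷ e) +_) (sumFin-0 n) ⟨
  f (0ℤ ∷ e) + sumFin n (λ _ → 0ℤ) ∎
  where open ≡-Reasoning
... | no x≢0 = begin
  f (x ∷ e)                                            ≡⟨ +-minus-cancel (f (x ∷ e)) (f (0ℤ ∷ e)) ⟨
  f (0ℤ ∷ e) + Δ f x e                                 ≡⟨ cong (f (0ℤ ∷ e) +_) (decompose-sum n (Δ f x) e (InDcoord-tail x≢0 d∈D)) ⟩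
  f (0ℤ ∷ e) + sumFin n (λ i → decompose n (Δ f x) i e) ∎
  where open ≡-Reasoning

lemma7p1 : (n : ℕ) → .{{_ : NonZero n}} → (f : Vec ℤ n → ℤ) → Σ (Fin n → Vec ℤ n → ℤ) (λ h → ((i : Fin n) (d : Vec ℤ n) (x : ℤ) → h i (d [ i ]≔ x) ≡ h i d) × ((d : Vec ℤ n) (p : InDcoord d) → f d ≡ sumFin n (λ i → h i d)))
lemma7p1 n f = decompose n f , decompose-[]≔ n f , decompose-sum n f
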